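{- For every positive integer $n$, $\tau(n)\ge \left\lfloor \frac{n-1}{2}\right\rfloor$.
   Context: Multi-pass stack sorting: in a pass, the entries of the current input are pushed one at a time, in order, onto a stack; whenever the top of the stack is the smallest value not yet output, it is popped to the output (repeatedly); entries are never popped otherwise. When all input entries have been pushed and no pop is possible, if the stack is nonempty the remaining entries are returned to the input in their original relative order and a new pass begins. The tier $t(\sigma)$ of a permutation $\sigma$ is one less than the minimum number of passes needed to output $1,\dots,n$. For a positive integer $n$, $\tau(n)$ denotes the maximum of $t(\sigma)$ over all permutations $\sigma$ of length $n$. -}

module Defs where

open import Data.Nat using (ℕ; zero; suc; _∸_; _≡ᵇ_)
open import Data.Bool using (if_then_else_)
open import Data.List using (List; []; _∷_; reverse; length; applyUpTo)
open import Data.Product using (_×_; _,_)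
open import Data.List.Relation.Binary.Permutation.Propositional using (_↭_)

-- Stacks are lists with the head as the top of the stack.

-- Pop repeatedly while the top equals m, the smallest value not yet output.
popAll : ℕ → List ℕ → ℕ × List ℕ
popAll m []      = m , []
popAll m (x ∷ s) = if x ≡ᵇ m then popAll (suc m) s else (m , x ∷ s)

pass : ℕ → List ℕ → List ℕ → ℕ × List ℕ
pass m s []       = m , s
pass m s (x ∷ xs) with popAll m (x ∷ s)
... | m' , s' = pass m' s' xs

-- The remaining stack is returned to the input in its original relative
-- order, i.e. reversed (bottom of the stack comes first).
-- Fuel: every pass outputs at least one entry, so  length input  passes
-- suffice; the fuel-exhausted clause is never reached in that case.
npasses : ℕ → ℕ → List ℕ → ℕ
npasses fuel    m []           = 0
npasses zero    m (x ∷ xs)     = 1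
npasses (suc f) m (x ∷ xs) with pass m [] (x ∷ xs)
... | m' , s' = suc (npasses f m' (reverse s'))

tier : List ℕ → ℕ
tier σ = npasses (length σ) 1 σ ∸ 1

IsPerm : ℕ → List ℕ → Set
IsPerm n σ = σ ↭ applyUpTo suc n

-- In  zigzag c k = c, c+2, …, c+2k-2, c+2k-1, …, c+3, c+1  (length 2k) a pass
-- outputs only c and c+1: after c+1 is popped, c+3 sits on top of the stack and
-- blocks c+2.  The stack is handed back as  zigzag (c+2) (k-1), so this
-- permutation needs exactly k passes.  Appending c to  zigzag (c+1) k  gives a
-- permutation of length 2k+1 whose first pass outputs c alone, so it needs k+1.
module Submission where

open import Defs
open import Data.Nat using (ℕ; suc; _∸_; _/_; _≤_)
open import Data.List using (List)
open import Data.Product using (Σ; _×_)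

open import Data.Nat using (zero; _+_; _*_; _≡ᵇ_; s≤s)
open import Data.Nat.Properties
  using (+-identityʳ; +-suc; *-comm; ≡⇒≡ᵇ; ≡ᵇ⇒≡; ≤-pred; >⇒≢; 1+n≢n; n≤1+n; m≤m+n; ≤-reflexive; ≤-trans)
open import Data.Nat.DivMod using (m<n*o⇒m/o<n)
open import Data.Bool using (true; false)
open import Data.Bool.Properties using (T-≡)
open import Data.List using ([]; _∷_; _++_; [_]; _∷ʳ_; _ʳ++_; reverse; map; upTo; applyUpTo)
open import Data.List.Properties using (reverse-++; reverse-involutive; map-cong; map-upTo; length-applyUpTo)
open import Data.List.Relation.Unary.All as All using (All; []; _∷_)
open import Data.List.Relation.Unary.All.Properties using (applyUpTo⁺₂)
open import Data.List.Relation.Binary.Permutation.Propositional using (_↭_; prep; ↭-refl; ↭-sym; ↭-trans)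
open import Data.List.Relation.Binary.Permutation.Propositional.Properties
  using (∷↭∷ʳ; ↭-length; All-resp-↭)
open import Data.Product using (_,_)
open import Function.Bundles using (Equivalence)
open import Relation.Binary.PropositionalEquality
  using (_≡_; _≢_; refl; sym; trans; cong; cong₂; subst; module ≡-Reasoning)
open import Relation.Nullary using (contradiction)

applyUpTo-cong : ∀ {A : Set} {f g : ℕ → A} → (∀ i → f i ≡ g i) → ∀ n → applyUpTo f n ≡ applyUpTo g n
applyUpTo-cong {f = f} {g} f≗g n = begin
  applyUpTo f n    ≡⟨ map-upTo f n ⟨
  map f (upTo n)   ≡⟨ map-cong f≗g (upTo n) ⟩
  map g (upTo n)   ≡⟨ map-upTo g n ⟩
  applyUpTo g n    ∎
  where open ≡-Reasoning

applyUpTo-+-suc : ∀ c n → applyUpTo (c +_) (suc n) ≡ c ∷ applyUpTo (suc c +_) n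
applyUpTo-+-suc c n = cong₂ _∷_ (+-identityʳ c) (applyUpTo-cong (+-suc c) n)

m≤1+k+k⇒m/2≤k : ∀ {m} k → m ≤ suc (k + k) → m / 2 ≤ k
m≤1+k+k⇒m/2≤k {m} k m≤1+k+k = ≤-pred (m<n*o⇒m/o<n {m} {suc k} {2} (s≤s m≤1+k*2))
  where
  k+k≡k*2 : k + k ≡ k * 2
  k+k≡k*2 = trans (cong (k +_) (sym (+-identityʳ k))) (*-comm 2 k)
  m≤1+k*2 : m ≤ suc (k * 2)
  m≤1+k*2 = subst (λ j → m ≤ suc j) k+k≡k*2 m≤1+k+k

popAll-head : ∀ c s → popAll c (c ∷ s) ≡ popAll (suc c) s
popAll-head c s rewrite Equivalence.to T-≡ (≡⇒≡ᵇ c c refl) = refl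

popAll-≢ : ∀ {c x} s → x ≢ c → popAll c (x ∷ s) ≡ (c , x ∷ s)
popAll-≢ {c} {x} s x≢c with x ≡ᵇ c in x≡ᵇc
... | false = refl
... | true  = contradiction (≡ᵇ⇒≡ x c (Equivalence.from T-≡ x≡ᵇc)) x≢c

pass-head : ∀ c xs → pass c [] (c ∷ xs) ≡ pass (suc c) [] xs
pass-head c xs = cong (λ (m , s) → pass m s xs) (popAll-head c [])

pass-++ : ∀ {c P} s ys → All (_≢ c) P → pass c s (P ++ ys) ≡ pass c (P ʳ++ s) ys
pass-++ s ys [] = refl
pass-++ {P = x ∷ P} s ys (x≢c ∷ P≢c) =
  trans (cong (λ (m , s′) → pass m s′ (P ++ ys)) (popAll-≢ s x≢c)) (pass-++ (x ∷ s) ys P≢c)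

pass-∷ʳ : ∀ {c P} → All (_≢ c) P → popAll (suc c) (reverse P) ≡ (suc c , reverse P) →
          pass c [] (P ∷ʳ c) ≡ (suc c , reverse P)
pass-∷ʳ {c} {P} P≢c blocked = begin
  pass c [] (P ++ [ c ])       ≡⟨ pass-++ [] [ c ] P≢c ⟩
  popAll c (c ∷ reverse P)     ≡⟨ popAll-head c (reverse P) ⟩
  popAll (suc c) (reverse P)   ≡⟨ blocked ⟩
  (suc c , reverse P)          ∎
  where open ≡-Reasoning

npasses-∷ : ∀ {f c} x xs {m} ys → pass c [] (x ∷ xs) ≡ (m , reverse ys) →
            npasses (suc f) c (x ∷ xs) ≡ suc (npasses f m ys)
npasses-∷ {f} _ _ ys eq =
  trans (cong (λ (m , s) → suc (npasses f m (reverse s))) eq)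
        (cong (λ zs → suc (npasses f _ zs)) (reverse-involutive ys))

npasses-∷ʳ : ∀ {f c} x xs {m} ys → pass c [] (xs ∷ʳ x) ≡ (m , reverse ys) →
             npasses (suc f) c (xs ∷ʳ x) ≡ suc (npasses f m ys)
npasses-∷ʳ x []       = npasses-∷ x []
npasses-∷ʳ x (y ∷ xs) = npasses-∷ y (xs ∷ʳ x)

zigzag : ℕ → ℕ → List ℕ
zigzag c zero    = []
zigzag c (suc k) = c ∷ (zigzag (suc (suc c)) k ∷ʳ suc c)

zigzag₁ : ℕ → ℕ → List ℕ
zigzag₁ c k = zigzag (suc c) k ∷ʳ c

zigzag-↭ : ∀ c k → zigzag c k ↭ applyUpTo (c +_) (k + k)
zigzag₁-↭ : ∀ c k → zigzag₁ c k ↭ applyUpTo (c +_) (suc (k + k))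

zigzag-↭ c zero    = ↭-refl
zigzag-↭ c (suc k) = subst (zigzag c (suc k) ↭_) shape (prep c (zigzag₁-↭ (suc c) k))
  where
  shape : c ∷ applyUpTo (suc c +_) (suc (k + k)) ≡ applyUpTo (c +_) (suc k + suc k)
  shape = trans (sym (applyUpTo-+-suc c (suc (k + k))))
                (cong (λ j → applyUpTo (c +_) (suc j)) (sym (+-suc k k)))

zigzag₁-↭ c k = ↭-trans (↭-sym (∷↭∷ʳ c (zigzag (suc c) k))) shape
  where
  shape : c ∷ zigzag (suc c) k ↭ applyUpTo (c +_) (suc (k + k))
  shape = subst (c ∷ zigzag (suc c) k ↭_) (sym (applyUpTo-+-suc c (k + k))) (prep c (zigzag-↭ (suc c) k))

zigzag-lower : ∀ c k → All (c ≤_) (zigzag c k)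
zigzag-lower c k = All-resp-↭ (↭-sym (zigzag-↭ c k)) (applyUpTo⁺₂ (c +_) (k + k) (m≤m+n c))

zigzag-blocks : ∀ c k → popAll c (reverse (zigzag c k)) ≡ (c , reverse (zigzag c k))
zigzag-blocks c zero    = refl
zigzag-blocks c (suc k) rewrite reverse-++ (c ∷ zigzag (suc (suc c)) k) [ suc c ] =
  popAll-≢ (reverse (c ∷ zigzag (suc (suc c)) k)) 1+n≢n

pass-zigzag₁ : ∀ c k → pass c [] (zigzag₁ c k) ≡ (suc c , reverse (zigzag (suc c) k))
pass-zigzag₁ c k = pass-∷ʳ (All.map >⇒≢ (zigzag-lower (suc c) k)) (zigzag-blocks (suc c) k)

pass-zigzag : ∀ c k → pass c [] (zigzag c (suc k)) ≡ (suc (suc c) , reverse (zigzag (suc (suc c)) k))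
pass-zigzag c k = trans (pass-head c (zigzag₁ (suc c) k)) (pass-zigzag₁ (suc c) k)

npasses-zigzag : ∀ {f} c k → k ≤ f → npasses f c (zigzag c k) ≡ k
npasses-zigzag c zero    _         = refl
npasses-zigzag c (suc k) (s≤s k≤f) =
  trans (npasses-∷ c (zigzag₁ (suc c) k) (zigzag (suc (suc c)) k) (pass-zigzag c k))
        (cong suc (npasses-zigzag (suc (suc c)) k k≤f))

npasses-zigzag₁ : ∀ {f} c k → k ≤ f → npasses (suc f) c (zigzag₁ c k) ≡ suc k
npasses-zigzag₁ c k k≤f =
  trans (npasses-∷ʳ c (zigzag (suc c) k) (zigzag (suc c) k) (pass-zigzag₁ c k))
        (cong suc (npasses-zigzag (suc c) k k≤f))

tier-perm : ∀ {n σ} → IsPerm n σ → tier σ ≡ npasses n 1 σ ∸ 1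
tier-perm {n} {σ} σ↭ = cong (λ fuel → npasses fuel 1 σ ∸ 1) (trans (↭-length σ↭) (length-applyUpTo suc n))

data Parity : ℕ → Set where
  even : ∀ k → Parity (k + k)
  odd  : ∀ k → Parity (suc (k + k))

parity : ∀ n → Parity n
parity zero = even 0
parity (suc n) with parity n
... | even k = odd k
... | odd k  = subst Parity (cong suc (+-suc k k)) (even (suc k))

tier-zigzag : ∀ k → tier (zigzag 1 (suc k)) ≡ k
tier-zigzag k = trans (tier-perm (zigzag-↭ 1 (suc k)))
                      (cong (_∸ 1) (npasses-zigzag 1 (suc k) (m≤m+n (suc k) (suc k))))

tier-zigzag₁ : ∀ k → tier (zigzag₁ 1 k) ≡ k
tier-zigzag₁ k = trans (tier-perm (zigzag₁-↭ 1 k)) (cong (_∸ 1) (npasses-zigzag₁ 1 k (m≤m+n k k)))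

lemma3p4 : (n : ℕ) → 1 ≤ n →
    Σ (List ℕ) λ σ → IsPerm n σ × ((n ∸ 1) / 2 ≤ tier σ)
lemma3p4 n 1≤n with parity n
... | even zero with () ← 1≤n
... | even (suc k) = zigzag 1 (suc k) , zigzag-↭ 1 (suc k) ,
  ≤-trans (m≤1+k+k⇒m/2≤k k (≤-reflexive (+-suc k k))) (≤-reflexive (sym (tier-zigzag k)))
... | odd k = zigzag₁ 1 k , zigzag₁-↭ 1 k ,
  ≤-trans (m≤1+k+k⇒m/2≤k k (n≤1+n (k + k))) (≤-reflexive (sym (tier-zigzag₁ k)))
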